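{- Let $\langle\mathbf{A}_{\mathrm d},\mathbf{A},\iota\rangle$ be a distributively generated (generalized) additive quantale with multiplication and let $\mathbf{Q}$ be an $\mathbf{A}$-module. Then: (i) if a congruence $\theta$ on $\mathbf{Q}$ is structural, then so is the additive consequence relation $\vdash_\theta$; (ii) if a nucleus $\gamma$ on $\mathbf{Q}$ is structural, then so is $\vdash_\gamma$; (iii) if an additive consequence relation $\vdash$ on $\mathbf{Q}$ is structural, then so are the congruence $\theta_\vdash$ and the nucleus $\gamma_\vdash$.
   Context: Fix one of two parallel settings: plain ("joins" = joins of arbitrary families) or generalized ("joins" = joins of non-empty families). A (generalized) quantale is $\langle Q,\bigvee,+,\mathsf{0}\rangle$ with $Q$ a poset having all such joins, $\langle Q,+,\mathsf{0}\rangle$ a monoid with $+$ order-preserving and distributing over such joins on both sides. A (generalized) additive quantale with multiplication is a triple $\langle\mathbf{A}_{\mathrm d},\mathbf{A},\iota\rangle$: $\mathbf{A}_{\mathrm d}$ a monoid, $\mathbf{A}$ a (generalized) quantale with an additional monoid structure $\langle A,\cdot,\mathsf 1\rangle$, $\iota\colon\mathbf{A}_{\mathrm d}\to\mathbf{A}$ a monoid homomorphism, such that $(\bigvee_i a_i)\cdot b=\bigvee_i(a_i\cdot b)$, $(a+b)\cdot c=a\cdot c+b\cdot c$, $\mathsf0\cdot a=\mathsf0$, and for $d\in\mathbf{A}_{\mathrm d}$ left multiplication by $\iota(d)$ preserves joins, $+$ and $\mathsf0$. It is distributively generated if $\mathbf{A}$ is generated as a (generalized) quantale by $\iota[\mathbf{A}_{\mathrm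 d}]$. An $\mathbf{A}$-module is a (generalized) quantale $\mathbf{Q}$ with a map $\ast\colon A\times Q\to Q$, order-preserving in both coordinates, with $(a\cdot b)\ast x=a\ast(b\ast x)$, $\mathsf1\ast x=x$, $(a+b)\ast x=a\ast x+b\ast x$, $\mathsf0\ast x=\mathsf0$, $(\bigvee_i a_i)\ast x=\bigvee_i(a_i\ast x)$, and for $d\in\mathbf{A}_{\mathrm d}$ the map $x\mapsto\iota(d)\ast x$ preserves $+$, $\mathsf0$ and joins. A congruence on $\mathbf{Q}$ is an equivalence relation compatible with $+$ and (non-empty) joins; it is structural if $\langle x,y\rangle\in\theta$ implies $\langle a\ast x,a\ast y\rangle\in\theta$ for all $a\in A$. An additive consequence relation is a relation $\vdash$ on $Q$ with: $x\geq y\Rightarrow x\vdash y$; transitivity; $x\vdash\bigvee\{y:x\vdash y\}$; $x\vdash y\Rightarrow x+z\vdash y+z$ and $z+x\vdash z+y$; it is structural if $x\vdash y$ implies $a\ast x\vdash a\ast y$ for all $a\in A$. A nucleus is an order-preserving, expansive, idempotent $\gamma\colon Q\to Q$ with $\gamma(x)+\gamma(y)\leq\gamma(x+y)$; it is structural if $a\ast\gamma(x)\leq\gamma(a\ast x)$ for all $a\in A$. Notation: $x\vdash_\theta y\iff\langle x\vee y,x\rangle\in\theta$; $x\vdash_\gamma y\iff y\leq\gamma(x)$; $\langle x,y\rangle\in\theta_\vdash\iff(x\vdash y$ and $y\vdash x)$; $\gamma_\vdash(x)=\bigvee\{y:x\vdash y\}$. -}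

module Defs where

open import Level using (Level; suc; _⊔_; Lift; lift)
open import Data.Bool using (Bool; true; false; if_then_else_)
open import Data.Unit using (⊤; tt)
open import Data.Product using (Σ; _×_; _,_; proj₁; proj₂)
open import Relation.Binary.PropositionalEquality using (_≡_; refl)
open import Relation.Binary.Structures using (IsPartialOrder; IsEquivalence)
open import Algebra.Structures using (IsMonoid)

-- Setting flag: gen = false : plain (joins of arbitrary families),
--               gen = true  : generalized (joins of non-empty families).
-- A family indexed by I : Set ℓ is admissible iff NE gen I is inhabited.
NE : ∀ {ℓ} → Bool → Set ℓ → Set ℓ
NE {ℓ} false I = Lift ℓ ⊤
NE true  I = I

ne-of : ∀ {ℓ} (gen : Bool) {I : Set ℓ} → I → NE gen I
ne-of false _ = lift tt
ne-of true  i = i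

record Quantale (gen : Bool) (ℓ : Level) : Set (suc ℓ) where
  infixl 6 _+_
  infix 4 _≤_
  field
    Carrier        : Set ℓ
    _≤_            : Carrier → Carrier → Set ℓ
    isPartialOrder : IsPartialOrder _≡_ _≤_
    ⋁              : (I : Set ℓ) → NE gen I → (I → Carrier) → Carrier
    ⋁-upper        : ∀ I ne (f : I → Carrier) i → f i ≤ ⋁ I ne f
    ⋁-least        : ∀ I ne (f : I → Carrier) z → (∀ i → f i ≤ z) → ⋁ I ne f ≤ z
    _+_            : Carrier → Carrier → Carrier
    0#             : Carrier
    +-isMonoid     : IsMonoid _≡_ _+_ 0#
    +-mono         : ∀ {x x' y y'} → x ≤ x' → y ≤ y' → x + y ≤ x' + y'
    +-distribˡ-⋁   : ∀ x I ne (f : I → Carrier) → x + ⋁ I ne f ≡ ⋁ I ne (λ i → x + f i)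
    +-distribʳ-⋁   : ∀ x I ne (f : I → Carrier) → ⋁ I ne f + x ≡ ⋁ I ne (λ i → f i + x)

  _∨_ : Carrier → Carrier → Carrier
  x ∨ y = ⋁ (Lift ℓ Bool) (ne-of gen (lift true)) (λ { (lift b) → if b then x else y })

record AddQuantaleMult (gen : Bool) (ℓ : Level) : Set (suc ℓ) where
  infixl 7 _·_
  field
    D          : Set ℓ
    _∙_        : D → D → D
    e          : D
    D-isMonoid : IsMonoid _≡_ _∙_ e
    A          : Quantale gen ℓ
  open Quantale A
  field
    _·_        : Carrier → Carrier → Carrier
    1#         : Carrier
    ·-isMonoid : IsMonoid _≡_ _·_ 1#
    ι          : D → Carrier
    ι-∙        : ∀ d d' → ι (d ∙ d') ≡ ι d · ι d'
    ι-e        : ι e ≡ 1#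
    ⋁-·        : ∀ I ne (f : I → Carrier) b → ⋁ I ne f · b ≡ ⋁ I ne (λ i → f i · b)
    +-·        : ∀ a b c → (a + b) · c ≡ a · c + b · c
    0-·        : ∀ a → 0# · a ≡ 0#
    ι-·-⋁      : ∀ d I ne (f : I → Carrier) → ι d · ⋁ I ne f ≡ ⋁ I ne (λ i → ι d · f i)
    ι-·-+      : ∀ d a b → ι d · (a + b) ≡ ι d · a + ι d · b
    ι-·-0      : ∀ d → ι d · 0# ≡ 0#

module _ {gen : Bool} {ℓ : Level} (M : AddQuantaleMult gen ℓ) where
  open AddQuantaleMult M
  open Quantale A

  data Generated : Carrier → Set (suc ℓ) where
    gen-ι : ∀ d → Generated (ι d)
    gen-0 : Generated 0#
    gen-+ : ∀ {a b} → Generated a → Generated b → Generated (a + b)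
    gen-⋁ : ∀ I ne (f : I → Carrier) → (∀ i → Generated (f i)) → Generated (⋁ I ne f)

  DistributivelyGenerated : Set (suc ℓ)
  DistributivelyGenerated = ∀ a → Generated a

record Module {gen : Bool} {ℓ : Level} (M : AddQuantaleMult gen ℓ) : Set (suc ℓ) where
  open AddQuantaleMult M using (A; _·_; 1#; ι)
  module AQ = Quantale A
  field
    Q : Quantale gen ℓ
  open Quantale Q
  infixr 7 _∗_
  field
    _∗_    : AQ.Carrier → Carrier → Carrier
    ∗-mono : ∀ {a a' x x'} → a AQ.≤ a' → x ≤ x' → a ∗ x ≤ a' ∗ x'
    ·-∗    : ∀ a b x → (a · b) ∗ x ≡ a ∗ (b ∗ x)
    1-∗    : ∀ x → 1# ∗ x ≡ x
    +-∗    : ∀ a b x → (a AQ.+ b) ∗ x ≡ a ∗ x + b ∗ x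
    0-∗    : ∀ x → AQ.0# ∗ x ≡ 0#
    ⋁-∗    : ∀ I ne (f : I → AQ.Carrier) x → AQ.⋁ I ne f ∗ x ≡ ⋁ I ne (λ i → f i ∗ x)
    ι-∗-+  : ∀ d x y → ι d ∗ (x + y) ≡ ι d ∗ x + ι d ∗ y
    ι-∗-0  : ∀ d → ι d ∗ 0# ≡ 0#
    ι-∗-⋁  : ∀ d I ne (f : I → Carrier) → ι d ∗ ⋁ I ne f ≡ ⋁ I ne (λ i → ι d ∗ f i)

module _ {gen : Bool} {ℓ : Level} {M : AddQuantaleMult gen ℓ} (𝐐 : Module M) where
  open Module 𝐐
  open Quantale Q

  Rel : Set (suc ℓ)
  Rel = Carrier → Carrier → Set ℓ

  record IsCongruence (θ : Rel) : Set (suc ℓ) where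
    field
      isEquivalence : IsEquivalence θ
      +-compat      : ∀ {x x' y y'} → θ x x' → θ y y' → θ (x + y) (x' + y')
      ⋁-compat      : ∀ I ne (f g : I → Carrier) → (∀ i → θ (f i) (g i)) → θ (⋁ I ne f) (⋁ I ne g)

  record IsAddConsequence (_⊢_ : Rel) : Set (suc ℓ) where
    field
      ≥⇒⊢    : ∀ {x y} → y ≤ x → x ⊢ y
      trans  : ∀ {x y z} → x ⊢ y → y ⊢ z → x ⊢ z
    refl⊢ : ∀ x → x ⊢ x
    refl⊢ x = ≥⇒⊢ (IsPartialOrder.refl isPartialOrder)
    ⋁⊢ : Carrier → Carrier
    ⋁⊢ x = ⋁ (Σ Carrier (λ y → x ⊢ y)) (ne-of gen (x , refl⊢ x)) proj₁
    field
      ⊢⋁     : ∀ x → x ⊢ ⋁⊢ x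
      +-cong : ∀ {x y} z → x ⊢ y → (x + z) ⊢ (y + z) × (z + x) ⊢ (z + y)

  record IsNucleus (γ : Carrier → Carrier) : Set ℓ where
    field
      mono       : ∀ {x y} → x ≤ y → γ x ≤ γ y
      expansive  : ∀ x → x ≤ γ x
      idempotent : ∀ x → γ (γ x) ≡ γ x
      +-lax      : ∀ x y → γ x + γ y ≤ γ (x + y)

  -- structurality (a congruence and a consequence relation use the same notion)
  StructuralRel : Rel → Set ℓ
  StructuralRel R = ∀ a {x y} → R x y → R (a ∗ x) (a ∗ y)

  StructuralNucleus : (Carrier → Carrier) → Set ℓ
  StructuralNucleus γ = ∀ a x → a ∗ γ x ≤ γ (a ∗ x)

  ⊢[_] : Rel → Rel
  ⊢[ θ ] x y = θ (x ∨ y) x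

  ⊢γ[_] : (Carrier → Carrier) → Rel
  ⊢γ[ γ ] x y = y ≤ γ x

  θ[_] : Rel → Rel
  θ[ _⊢_ ] x y = (x ⊢ y) × (y ⊢ x)

  γ[_] : {_⊢_ : Rel} → IsAddConsequence _⊢_ → Carrier → Carrier
  γ[ c ] = IsAddConsequence.⋁⊢ c

module Submission where

open import Defs
open import Level using (Level; lift)
open import Data.Bool using (Bool; true; false)
open import Data.Product using (_×_; _,_)
open import Relation.Binary.PropositionalEquality using (_≡_; subst₂)
open import Relation.Binary.Structures using (IsPartialOrder; IsEquivalence)

-- Each part is a one-step transfer of structurality; in part (i) the one idea is that a
-- congruence class is convex: from ⟨a∗(x∨y), a∗x⟩ ∈ θ and a∗x ≤ a∗x ∨ a∗y ≤ a∗(x∨y), joining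
-- with a∗x ∨ a∗y puts a∗x ∨ a∗y in the same class.

module _ {ℓ : Level} {gen : Bool} {M : AddQuantaleMult gen ℓ} (𝐐 : Module M) where
  open Module 𝐐
  open Quantale Q
  private
    module ≤ = IsPartialOrder isPartialOrder
    module A≤ = IsPartialOrder AQ.isPartialOrder

  ∨-upperˡ : ∀ x y → x ≤ x ∨ y
  ∨-upperˡ x y = ⋁-upper _ _ _ (lift true)

  ∨-upperʳ : ∀ x y → y ≤ x ∨ y
  ∨-upperʳ x y = ⋁-upper _ _ _ (lift false)

  ∨-least : ∀ {x y z} → x ≤ z → y ≤ z → x ∨ y ≤ z
  ∨-least x≤z y≤z = ⋁-least _ _ _ _ λ { (lift true) → x≤z ; (lift false) → y≤z }

  y≤x⇒x∨y≡x : ∀ {x y} → y ≤ x → x ∨ y ≡ x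
  y≤x⇒x∨y≡x {x} {y} y≤x = ≤.antisym (∨-least ≤.refl y≤x) (∨-upperˡ x y)

  x≤y⇒x∨y≡y : ∀ {x y} → x ≤ y → x ∨ y ≡ y
  x≤y⇒x∨y≡y {x} {y} x≤y = ≤.antisym (∨-least x≤y ≤.refl) (∨-upperʳ x y)

  ∗-monoʳ : ∀ a {x y} → x ≤ y → a ∗ x ≤ a ∗ y
  ∗-monoʳ a = ∗-mono A≤.refl

  ∗-∨-≤ : ∀ a x y → (a ∗ x) ∨ (a ∗ y) ≤ a ∗ (x ∨ y)
  ∗-∨-≤ a x y = ∨-least (∗-monoʳ a (∨-upperˡ x y)) (∗-monoʳ a (∨-upperʳ x y))

  module _ {θ : Rel 𝐐} (cong : IsCongruence 𝐐 θ) where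
    open IsCongruence cong
    private module θ = IsEquivalence isEquivalence

    ∨-compat : ∀ {x x' y y'} → θ x x' → θ y y' → θ (x ∨ y) (x' ∨ y')
    ∨-compat θxx' θyy' = ⋁-compat _ _ _ _ λ { (lift true) → θxx' ; (lift false) → θyy' }

    congruence-convex : ∀ {u v w} → θ u w → w ≤ v → v ≤ u → θ u v
    congruence-convex θuw w≤v v≤u =
      subst₂ θ (y≤x⇒x∨y≡x v≤u) (x≤y⇒x∨y≡y w≤v) (∨-compat θuw θ.refl)

    structural-⊢[] : StructuralRel 𝐐 θ → StructuralRel 𝐐 (⊢[_] 𝐐 θ)
    structural-⊢[] θ-str a {x} {y} x⊢y = θ.trans (θ.sym θuv) θuw
      where
        θuw : θ (a ∗ (x ∨ y)) (a ∗ x)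
        θuw = θ-str a x⊢y
        θuv : θ (a ∗ (x ∨ y)) ((a ∗ x) ∨ (a ∗ y))
        θuv = congruence-convex θuw (∨-upperˡ _ _) (∗-∨-≤ a x y)

  structural-⊢γ[] : ∀ {γ} → StructuralNucleus 𝐐 γ → StructuralRel 𝐐 (⊢γ[_] 𝐐 γ)
  structural-⊢γ[] γ-str a {x} y≤γx = ≤.trans (∗-monoʳ a y≤γx) (γ-str a x)

  structural-θ[] : ∀ {R} → StructuralRel 𝐐 R → StructuralRel 𝐐 (θ[_] 𝐐 R)
  structural-θ[] R-str a (Rxy , Ryx) = R-str a Rxy , R-str a Ryx

  module _ {_⊢_ : Rel 𝐐} (c : IsAddConsequence 𝐐 _⊢_) where
    open IsAddConsequence c using (⊢⋁)

    ⊢⇒≤γ[] : ∀ {x y} → x ⊢ y → y ≤ γ[_] 𝐐 c x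
    ⊢⇒≤γ[] {x} {y} x⊢y = ⋁-upper _ _ _ (y , x⊢y)

    structural-γ[] : StructuralRel 𝐐 _⊢_ → StructuralNucleus 𝐐 (γ[_] 𝐐 c)
    structural-γ[] ⊢-str a x = ⊢⇒≤γ[] (⊢-str a (⊢⋁ x))

theorem5p10 : {ℓ : Level} (gen : Bool) (M : AddQuantaleMult gen ℓ) → DistributivelyGenerated M → (𝐐 : Module M) →
    ((θ : Rel 𝐐) → IsCongruence 𝐐 θ → StructuralRel 𝐐 θ → StructuralRel 𝐐 (⊢[_] 𝐐 θ))
    × ((γ : Quantale.Carrier (Module.Q 𝐐) → Quantale.Carrier (Module.Q 𝐐)) → IsNucleus 𝐐 γ → StructuralNucleus 𝐐 γ → StructuralRel 𝐐 (⊢γ[_] 𝐐 γ))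
    × ((⊢ : Rel 𝐐) (c : IsAddConsequence 𝐐 ⊢) → StructuralRel 𝐐 ⊢ → StructuralRel 𝐐 (θ[_] 𝐐 ⊢) × StructuralNucleus 𝐐 (γ[_] 𝐐 c))
theorem5p10 gen M _ 𝐐 =
    (λ _ cong → structural-⊢[] 𝐐 cong)
  , (λ γ _ → structural-⊢γ[] 𝐐)
  , (λ ⊢ c ⊢-str → structural-θ[] 𝐐 ⊢-str , structural-γ[] 𝐐 c ⊢-str)
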